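{- Let $m\ge 0$, $r\ge 1$ be integers, let $G$ be a connected graph with exactly $m$ edges and maximum degree at most $r$, and let $T$ be a cluster of $G$ with associated blue graph $B=B_T$. Then for every $t\ge 2$, the number of cliques of $G$ on $t$ vertices that contain at least one edge of $B$ is at most $\binom{e(B)}{t-1}$.
   Context: All graphs are finite and simple; $e(H)$ denotes the number of edges of $H$. For a graph $G$ of maximum degree at most $r$, a nonempty clique $T\subseteq V(G)$ is tight if the set $N(T)$ of common neighbours of all vertices of $T$ has size $r+1-|T|$; a cluster is an inclusion-maximal tight clique. For a cluster $T$, let $S_T=N(T)$, and let $B_T$ be the graph consisting of all edges $uv$ of $G$ with $u\in S_T$ and $v\in V(G)\setminus(T\cup S_T)$ (the "blue edges"). -}

module Defs where

open import Data.Bool using (Bool; true; false; _∧_; _∨_; not; T)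
open import Data.Nat using (ℕ; zero; suc; _+_; _<ᵇ_)
open import Data.Fin using (Fin; toℕ)
open import Data.Vec using (Vec; []; _∷_; lookup; tabulate)
open import Data.List using (List; []; _∷_; length; filterᵇ; allFin; concatMap; map; _++_)
open import Data.Bool.ListAction using (all; any)
open import Data.Product using (_×_; _,_; Σ; ∃)
open import Relation.Binary.PropositionalEquality using (_≡_)

record Graph (n : ℕ) : Set where
  field
    adj    : Fin n → Fin n → Bool
    sym    : ∀ i j → adj i j ≡ adj j i
    irrefl : ∀ i → adj i i ≡ false
open Graph public

VSet : ℕ → Set
VSet n = Vec Bool n

_∈ᵇ_ : ∀ {n} → Fin n → VSet n → Bool
i ∈ᵇ S = lookup S i

count : ∀ {A : Set} → (A → Bool) → List A → ℕ
count p xs = length (filterᵇ p xs)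

card : ∀ {n} → VSet n → ℕ
card {n} S = count (λ i → i ∈ᵇ S) (allFin n)

allSubsets : (n : ℕ) → List (VSet n)
allSubsets zero = [] ∷ []
allSubsets (suc n) = map (true ∷_) (allSubsets n) ++ map (false ∷_) (allSubsets n)

-- unordered pairs {i,j} encoded as ordered pairs with i < j
pairs : (n : ℕ) → List (Fin n × Fin n)
pairs n = concatMap (λ i → map (λ j → (i , j)) (filterᵇ (λ j → toℕ i <ᵇ toℕ j) (allFin n))) (allFin n)

numEdges : ∀ {n} → Graph n → ℕ
numEdges {n} G = count (λ { (i , j) → adj G i j }) (pairs n)

degree : ∀ {n} → Graph n → Fin n → ℕ
degree {n} G v = count (adj G v) (allFin n)

MaxDegreeAtMost : ∀ {n} → Graph n → ℕ → Set
MaxDegreeAtMost G r = ∀ v → degree G v Data.Nat.≤ r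

data Reachable {n} (G : Graph n) : Fin n → Fin n → Set where
  here : ∀ {u} → Reachable G u u
  step : ∀ {u v w} → T (adj G u v) → Reachable G v w → Reachable G u w

Connected : ∀ {n} → Graph n → Set
Connected G = ∀ u v → Reachable G u v

_⊆ᵛ_ : ∀ {n} → VSet n → VSet n → Set
S ⊆ᵛ S' = ∀ i → T (i ∈ᵇ S) → T (i ∈ᵇ S')

isCliqueᵇ : ∀ {n} → Graph n → VSet n → Bool
isCliqueᵇ {n} G S = all (λ { (i , j) → not (i ∈ᵇ S ∧ j ∈ᵇ S) ∨ adj G i j }) (pairs n)

IsClique : ∀ {n} → Graph n → VSet n → Set
IsClique G S = T (isCliqueᵇ G S)

Nonempty : ∀ {n} → VSet n → Set
Nonempty S = ∃ λ i → T (i ∈ᵇ S)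

commonNbhd : ∀ {n} → Graph n → VSet n → VSet n
commonNbhd {n} G S = tabulate (λ v → all (λ i → not (i ∈ᵇ S) ∨ adj G i v) (allFin n))

-- tight clique: nonempty clique with |N(S)| = r + 1 - |S|  (stated as |N(S)| + |S| = r + 1)
Tight : ∀ {n} → Graph n → ℕ → VSet n → Set
Tight G r S = Nonempty S × IsClique G S × (card (commonNbhd G S) + card S ≡ suc r)

IsCluster : ∀ {n} → Graph n → ℕ → VSet n → Set
IsCluster G r S = Tight G r S × (∀ S' → Tight G r S' → S ⊆ᵛ S' → S' ⊆ᵛ S)

isBlueᵇ : ∀ {n} → Graph n → VSet n → Fin n → Fin n → Bool
isBlueᵇ G Tc u v =
  adj G u v ∧ ((u ∈ᵇ S ∧ not (v ∈ᵇ Tc ∨ v ∈ᵇ S)) ∨ (v ∈ᵇ S ∧ not (u ∈ᵇ Tc ∨ u ∈ᵇ S)))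
  where S = commonNbhd G Tc

numBlueEdges : ∀ {n} → Graph n → VSet n → ℕ
numBlueEdges {n} G Tc = count (λ { (u , v) → isBlueᵇ G Tc u v }) (pairs n)

containsBlueᵇ : ∀ {n} → Graph n → VSet n → VSet n → Bool
containsBlueᵇ {n} G Tc K = any (λ { (u , v) → u ∈ᵇ K ∧ v ∈ᵇ K ∧ isBlueᵇ G Tc u v }) (pairs n)

numBlueCliques : ∀ {n} → Graph n → VSet n → ℕ → ℕ
numBlueCliques {n} G Tc t =
  count (λ K → (card K Data.Nat.≡ᵇ t) ∧ isCliqueᵇ G K ∧ containsBlueᵇ G Tc K) (allSubsets n)

module Submission where

-- Proposition 3.3.  Let T be a cluster of a graph G of maximum degree at
-- most r, S = N(T), and call a vertex "outside" if it lies in neither T nor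
-- S.
--
-- A vertex of a tight clique already has
-- |T| - 1 + |S| = r neighbours in T ∪ S, so it has no outside neighbour.
-- Hence a clique K containing a blue edge a₀c₀ (a₀ ∈ S, c₀ outside) misses T:
-- every vertex of K is adjacent to c₀.  So every w ∈ K - {a₀} is in S or
-- outside, and the edge joining w to c₀ (if w ∈ S) or to a₀ (if w is
-- outside) is blue.  These |K| - 1 blue edges form a "double star" F_K whose
-- endpoints are exactly K.  Thus K ↦ F_K is a left-invertible assignment of a
-- (t-1)-element set of blue edges to every blue t-clique, which gives the
-- bound  #blue t-cliques ≤ C(e(B), t-1).

open import Defs hiding (sym)
open import Data.Bool using (Bool; true; false; _∧_; _∨_; not; T; if_then_else_)
open import Data.Bool.Properties using (T-∧; T-∨; T-not-≡; T-≡)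
open import Data.Bool.ListAction using (any)
open import Data.Nat using (ℕ; zero; suc; _+_; _∸_; _≤_; _<_; _≥_; z≤n; s≤s; _<ᵇ_; _≡ᵇ_)
open import Data.Nat.Properties
  using (m≤n⇒m≤1+n; +-suc; +-comm; ≤-trans; ≤-antisym; ≤-reflexive; module ≤-Reasoning
        ; <-cmp; <-asym; <-irrefl; <⇒<ᵇ; <ᵇ⇒<; ≡⇒≡ᵇ; ≡ᵇ⇒≡)
open import Data.Nat.Combinatorics using (_C_; nCk+nC[k+1]≡[n+1]C[k+1])
open import Data.Fin using (Fin; toℕ; _≟_)
open import Data.Fin.Properties using (toℕ-injective)
open import Data.Vec using (lookup; tabulate)
import Data.Vec as Vec
open import Data.Vec.Properties using (lookup∘tabulate; tabulate-cong; tabulate∘lookup; ∷-injectiveʳ)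
open import Data.List using (List; []; _∷_; length; filterᵇ; map; _++_; concatMap; allFin)
open import Data.List.Properties using (length-map; length-++; filter-++; filter-none)
open import Data.List.Membership.Propositional using (_∈_; find; lose)
open import Data.List.Membership.Propositional.Properties
  using (∈-++⁻; ∈-++⁺ˡ; ∈-++⁺ʳ; ∈-map⁺; ∈-map⁻; ∈-allFin; ∈-filter⁺; ∈-filter⁻; ∈-∃++
        ; ∈-concatMap⁺; ∈-concatMap⁻)
open import Data.List.Relation.Binary.Subset.Propositional using (_⊆_)
open import Data.List.Relation.Unary.Unique.Propositional using (Unique)
open import Data.List.Relation.Unary.Unique.Propositional.Properties using (allFin⁺; map⁺; ++⁺; filter⁺)
open import Data.List.Relation.Unary.Any using (here; there)
open import Data.List.Relation.Unary.Any.Properties using (any⁺; any⁻)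
open import Data.List.Relation.Unary.All as All using (All; []; _∷_)
open import Data.List.Relation.Unary.AllPairs using ([]; _∷_)
open import Data.List.Relation.Unary.All.Properties using (all⁺)
open import Data.Product using (_×_; _,_; ∃; proj₁; proj₂)
open import Data.Sum using (_⊎_; inj₁; inj₂; swap) renaming (map to ⊎-map)
open import Data.Empty using (⊥-elim)
open import Data.Unit using (tt)
open import Function using (_∘_)
open import Function.Bundles using (Equivalence)
open import Relation.Nullary using (¬_; does; yes; no; T?)
open import Relation.Nullary.Decidable using (dec-true; dec-false)
open import Relation.Binary.Definitions using (DecidableEquality; tri<; tri≈; tri>)
open import Relation.Binary.PropositionalEquality
  using (_≡_; _≢_; refl; sym; trans; cong; cong₂; subst; module ≡-Reasoning)

open Equivalence using (to; from)

T-ext : ∀ {a b} → (T a → T b) → (T b → T a) → a ≡ b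
T-ext {false} {false} _ _ = refl
T-ext {false} {true}  _ g = ⊥-elim (g tt)
T-ext {true}  {false} f _ = ⊥-elim (f tt)
T-ext {true}  {true}  _ _ = refl

vset-ext : ∀ {n} {A B : VSet n} →
  (∀ i → T (i ∈ᵇ A) → T (i ∈ᵇ B)) → (∀ i → T (i ∈ᵇ B) → T (i ∈ᵇ A)) → A ≡ B
vset-ext {A = A} {B} A⊆B B⊆A = begin
  A                   ≡⟨ tabulate∘lookup A ⟨
  tabulate (lookup A) ≡⟨ tabulate-cong (λ i → T-ext (A⊆B i) (B⊆A i)) ⟩
  tabulate (lookup B) ≡⟨ tabulate∘lookup B ⟩
  B ∎
  where open ≡-Reasoning

_=ᵇ_ _≠ᵇ_ : ∀ {n} → Fin n → Fin n → Bool
x =ᵇ a = does (x ≟ a)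
x ≠ᵇ a = not (x =ᵇ a)

=ᵇ-sound : ∀ {n} {x a : Fin n} → T (x =ᵇ a) → x ≡ a
=ᵇ-sound {x = x} {a} x=a with x ≟ a
... | yes x≡a = x≡a

=ᵇ-complete : ∀ {n} {x a : Fin n} → x ≡ a → T (x =ᵇ a)
=ᵇ-complete {x = x} {a} x≡a = from T-≡ (dec-true (x ≟ a) x≡a)

≠ᵇ-sound : ∀ {n} {x a : Fin n} → T (x ≠ᵇ a) → x ≢ a
≠ᵇ-sound x≠a x≡a = subst T (to T-not-≡ x≠a) (=ᵇ-complete x≡a)

≠ᵇ-complete : ∀ {n} {x a : Fin n} → x ≢ a → T (x ≠ᵇ a)
≠ᵇ-complete {x = x} {a} x≢a = from T-not-≡ (dec-false (x ≟ a) x≢a)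

module _ {A : Set} where

  count-mono : (p q : A → Bool) (xs : List A) → (∀ x → T (p x) → T (q x)) → count p xs ≤ count q xs
  count-mono p q [] _ = z≤n
  count-mono p q (x ∷ xs) p⇒q with p x in px | q x in qx
  ... | true  | true  = s≤s (count-mono p q xs p⇒q)
  ... | true  | false = ⊥-elim (subst T qx (p⇒q x (subst T (sym px) tt)))
  ... | false | true  = m≤n⇒m≤1+n (count-mono p q xs p⇒q)
  ... | false | false = count-mono p q xs p⇒q

  count-disjoint : (p q : A → Bool) (xs : List A) → (∀ x → T (p x) → ¬ T (q x)) →
    count (λ x → p x ∨ q x) xs ≡ count p xs + count q xs
  count-disjoint p q [] _ = refl
  count-disjoint p q (x ∷ xs) p#q with p x in px | q x in qx
  ... | true  | true  = ⊥-elim (p#q x (subst T (sym px) tt) (subst T (sym qx) tt))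
  ... | true  | false = cong suc (count-disjoint p q xs p#q)
  ... | false | true  = trans (cong suc (count-disjoint p q xs p#q)) (sym (+-suc _ _))
  ... | false | false = count-disjoint p q xs p#q

  ⊆-length : {xs ys : List A} → Unique xs → xs ⊆ ys → length xs ≤ length ys
  ⊆-length {[]} _ _ = z≤n
  ⊆-length {x ∷ xs} {ys} (x∉xs ∷ u) xs⊆ys with ∈-∃++ (xs⊆ys (here refl))
  ... | as , bs , refl = begin
      suc (length xs)             ≤⟨ s≤s (⊆-length u xs⊆as++bs) ⟩
      suc (length (as ++ bs))     ≡⟨ cong suc (length-++ as) ⟩
      suc (length as + length bs) ≡⟨ +-suc (length as) (length bs) ⟨
      length as + length (x ∷ bs) ≡⟨ length-++ as ⟨
      length (as ++ x ∷ bs)       ∎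
    where
    open ≤-Reasoning
    xs⊆as++bs : xs ⊆ as ++ bs
    xs⊆as++bs {y} y∈xs with ∈-++⁻ as (xs⊆ys (there y∈xs))
    ... | inj₁ y∈as = ∈-++⁺ˡ y∈as
    ... | inj₂ (here refl) = ⊥-elim (All.lookup x∉xs y∈xs refl)
    ... | inj₂ (there y∈bs) = ∈-++⁺ʳ as y∈bs

module _ {A : Set} (_≟ᴬ_ : DecidableEquality A) where

  count-remove : (p : A → Bool) {a : A} {xs : List A} → Unique xs → a ∈ xs → T (p a) →
    count p xs ≡ suc (count (λ x → p x ∧ not (does (x ≟ᴬ a))) xs)
  count-remove p {a} {.a ∷ xs} (a∉xs ∷ _) (here refl) pa with p a | a ≟ᴬ a
  ... | true | yes _ = cong suc (without-a xs a∉xs)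
    where
    without-a : ∀ ys → All (a ≢_) ys → count p ys ≡ count (λ x → p x ∧ not (does (x ≟ᴬ a))) ys
    without-a [] [] = refl
    without-a (y ∷ ys) (a≢y ∷ a∉ys) with p y | y ≟ᴬ a
    ... | true  | yes y≡a = ⊥-elim (a≢y (sym y≡a))
    ... | true  | no _ = cong suc (without-a ys a∉ys)
    ... | false | _ = without-a ys a∉ys
  ... | true | no a≢a = ⊥-elim (a≢a refl)
  count-remove p {a} {y ∷ xs} (y∉xs ∷ u) (there a∈xs) pa with p y | y ≟ᴬ a
  ... | true  | yes refl = ⊥-elim (All.lookup y∉xs a∈xs refl)
  ... | true  | no _ = cong suc (count-remove p u a∈xs pa)
  ... | false | _ = count-remove p u a∈xs pa

  count-≟ : {a : A} {xs : List A} → Unique xs → a ∈ xs → count (λ x → does (x ≟ᴬ a)) xs ≡ 1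
  count-≟ {a} {xs} u a∈xs = trans (count-remove (λ x → does (x ≟ᴬ a)) u a∈xs (from T-≡ (dec-true (a ≟ᴬ a) refl)))
    (cong (suc ∘ length) (filter-none _ {xs = xs} (All.tabulate λ {x} _ → never (does (x ≟ᴬ a)))))
    where
    never : ∀ b → ¬ T (b ∧ not b)
    never false ()
    never true ()

module _ {A B : Set} where

  map-unique-on : (f : A → B) {xs : List A} → (∀ {x y} → x ∈ xs → y ∈ xs → f x ≡ f y → x ≡ y) →
    Unique xs → Unique (map f xs)
  map-unique-on f {[]} _ [] = []
  map-unique-on f {x ∷ xs} inj (x∉xs ∷ u) =
    All.tabulate (λ fy∈ fx≡ → let y , y∈xs , fy≡ = ∈-map⁻ f fy∈ in
                   All.lookup x∉xs y∈xs (inj (here refl) (there y∈xs) (trans fx≡ fy≡)))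
    ∷ map-unique-on f (λ x∈ y∈ → inj (there x∈) (there y∈)) u

  cover-length : (g : B → A) {xs : List A} {ys : List B} → Unique xs →
    (∀ {x} → x ∈ xs → ∃ λ y → y ∈ ys × g y ≡ x) → length xs ≤ length ys
  cover-length g {xs} {ys} u cover = ≤-trans (⊆-length u xs⊆gys) (≤-reflexive (length-map g ys))
    where
    xs⊆gys : xs ⊆ map g ys
    xs⊆gys x∈ = let y , y∈ , gy≡x = cover x∈ in subst (_∈ map g ys) gy≡x (∈-map⁺ g y∈)

module _ {A : Set} where

  sublists : List A → List (List A)
  sublists [] = [] ∷ []
  sublists (x ∷ xs) = map (x ∷_) (sublists xs) ++ sublists xs

  filter∈sublists : (p : A → Bool) (xs : List A) → filterᵇ p xs ∈ sublists xs
  filter∈sublists p [] = here refl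
  filter∈sublists p (x ∷ xs) with p x
  ... | true  = ∈-++⁺ˡ (∈-map⁺ (x ∷_) (filter∈sublists p xs))
  ... | false = ∈-++⁺ʳ _ (filter∈sublists p xs)

  HasLength : ℕ → List A → Bool
  HasLength k l = length l ≡ᵇ k

  count-cons : (x : A) (k : ℕ) (L : List (List A)) →
    count (HasLength k) (map (x ∷_) L) ≡ count (λ l → suc (length l) ≡ᵇ k) L
  count-cons x k [] = refl
  count-cons x k (l ∷ L) with suc (length l) ≡ᵇ k
  ... | true  = cong suc (count-cons x k L)
  ... | false = count-cons x k L

  count-no-length : (L : List (List A)) → count (λ l → suc (length l) ≡ᵇ 0) L ≡ 0
  count-no-length L = cong length (filter-none (T? ∘ λ l → suc (length l) ≡ᵇ 0) {xs = L} (All.tabulate λ _ ()))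

  count-sublists : (k : ℕ) (xs : List A) → count (HasLength k) (sublists xs) ≡ length xs C k
  count-sublists zero [] = refl
  count-sublists (suc k) [] = refl
  count-sublists k (x ∷ xs) = begin
      count (HasLength k) (map (x ∷_) (sublists xs) ++ sublists xs)
        ≡⟨ cong length (filter-++ (T? ∘ HasLength k) (map (x ∷_) (sublists xs)) (sublists xs)) ⟩
      length (filterᵇ (HasLength k) (map (x ∷_) (sublists xs)) ++ filterᵇ (HasLength k) (sublists xs))
        ≡⟨ length-++ (filterᵇ (HasLength k) (map (x ∷_) (sublists xs))) ⟩
      count (HasLength k) (map (x ∷_) (sublists xs)) + count (HasLength k) (sublists xs)
        ≡⟨ cong₂ _+_ (count-cons x k (sublists xs)) (count-sublists k xs) ⟩
      count (λ l → suc (length l) ≡ᵇ k) (sublists xs) + length xs C k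
        ≡⟨ pascal k ⟩
      suc (length xs) C k ∎
    where
    open ≡-Reasoning
    pascal : ∀ k → count (λ l → suc (length l) ≡ᵇ k) (sublists xs) + length xs C k ≡ suc (length xs) C k
    pascal zero = cong (_+ 1) (count-no-length (sublists xs))
    pascal (suc k) = trans (cong (_+ length xs C suc k) (count-sublists k xs))
                           (nCk+nC[k+1]≡[n+1]C[k+1] (length xs) k)

allSubsets-unique : ∀ n → Unique (allSubsets n)
allSubsets-unique zero = [] ∷ []
allSubsets-unique (suc n) =
  ++⁺ (map⁺ ∷-injectiveʳ (allSubsets-unique n)) (map⁺ ∷-injectiveʳ (allSubsets-unique n)) heads-differ
  where
  heads-differ : ∀ {v} → ¬ (v ∈ map (true Vec.∷_) (allSubsets n) × v ∈ map (false Vec.∷_) (allSubsets n))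
  heads-differ (v∈true , v∈false) with ∈-map⁻ (true Vec.∷_) v∈true | ∈-map⁻ (false Vec.∷_) v∈false
  ... | _ , _ , refl | _ , _ , ()

module Pairs {n : ℕ} where

  pairsFrom : Fin n → List (Fin n × Fin n)
  pairsFrom i = map (i ,_) (filterᵇ (λ j → toℕ i <ᵇ toℕ j) (allFin n))

  pairs⁺ : ∀ {i j} → toℕ i < toℕ j → (i , j) ∈ pairs n
  pairs⁺ {i} {j} i<j = ∈-concatMap⁺ pairsFrom (lose (∈-allFin i)
    (∈-map⁺ (i ,_) (∈-filter⁺ (T? ∘ λ j → toℕ i <ᵇ toℕ j) (∈-allFin j) (<⇒<ᵇ i<j))))

  pairs⁻ : ∀ {i j} → (i , j) ∈ pairs n → toℕ i < toℕ j
  pairs⁻ {i} {j} ij∈ with find (∈-concatMap⁻ pairsFrom {xs = allFin n} ij∈)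
  ... | i′ , _ , ij∈′ with ∈-map⁻ (i′ ,_) ij∈′
  ... | _ , j∈ , refl = <ᵇ⇒< (toℕ i) (toℕ j) (proj₂ (∈-filter⁻ (T? ∘ λ j → toℕ i <ᵇ toℕ j) {xs = allFin n} j∈))

  -- pairs n is the concatenation of duplicate-free blocks pairsFrom i, and
  -- different blocks have different first coordinates.
  pairs-unique : Unique (pairs n)
  pairs-unique = concat-unique (allFin n) (allFin⁺ n)
    where
    first∈ : ∀ i {e} → e ∈ pairsFrom i → proj₁ e ≡ i
    first∈ i e∈ = let _ , _ , e≡ = ∈-map⁻ (i ,_) e∈ in cong proj₁ e≡
    concat-unique : (is : List (Fin n)) → Unique is → Unique (concatMap pairsFrom is)
    concat-unique [] [] = []
    concat-unique (i ∷ is) (i∉is ∷ u) =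
      ++⁺ (map⁺ (cong proj₂) (filter⁺ _ (allFin⁺ n))) (concat-unique is u) disjoint
      where
      disjoint : ∀ {e} → ¬ (e ∈ pairsFrom i × e ∈ concatMap pairsFrom is)
      disjoint (e∈i , e∈is) with find (∈-concatMap⁻ pairsFrom {xs = is} e∈is)
      ... | i′ , i′∈is , e∈i′ = All.lookup i∉is i′∈is (trans (sym (first∈ i e∈i)) (first∈ i′ e∈i′))

  sorted : Fin n → Fin n → Fin n × Fin n
  sorted a b = if toℕ a <ᵇ toℕ b then (a , b) else (b , a)

  sorted-cases : ∀ a b → sorted a b ≡ (a , b) ⊎ sorted a b ≡ (b , a)
  sorted-cases a b with toℕ a <ᵇ toℕ b
  ... | true  = inj₁ refl
  ... | false = inj₂ refl

  sorted-of-sorted : ∀ {x y} → toℕ x < toℕ y → sorted x y ≡ (x , y) × sorted y x ≡ (x , y)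
  sorted-of-sorted {x} {y} x<y = forwards , backwards
    where
    forwards : sorted x y ≡ (x , y)
    forwards with toℕ x <ᵇ toℕ y | <⇒<ᵇ x<y
    ... | true | _ = refl
    backwards : sorted y x ≡ (x , y)
    backwards with toℕ y <ᵇ toℕ x in y<ᵇx
    ... | true  = ⊥-elim (<-asym x<y (<ᵇ⇒< (toℕ y) (toℕ x) (subst T (sym y<ᵇx) tt)))
    ... | false = refl

  sorted∈pairs : ∀ {a b} → a ≢ b → sorted a b ∈ pairs n
  sorted∈pairs {a} {b} a≢b with <-cmp (toℕ a) (toℕ b)
  ... | tri< a<b _ _ = subst (_∈ pairs n) (sym (proj₁ (sorted-of-sorted a<b))) (pairs⁺ a<b)
  ... | tri≈ _ a≡b _ = ⊥-elim (a≢b (toℕ-injective a≡b))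
  ... | tri> _ _ b<a = subst (_∈ pairs n) (sym (proj₂ (sorted-of-sorted b<a))) (pairs⁺ b<a)

  sorted-both : (R : Fin n → Fin n → Set) → ∀ {a b} → R a b → R b a → R (proj₁ (sorted a b)) (proj₂ (sorted a b))
  sorted-both R {a} {b} rab rba with sorted a b | sorted-cases a b
  ... | _ | inj₁ refl = rab
  ... | _ | inj₂ refl = rba

  sorted-injective : ∀ {a b a′ b′} → sorted a b ≡ sorted a′ b′ → (a ≡ a′ × b ≡ b′) ⊎ (a ≡ b′ × b ≡ a′)
  sorted-injective {a} {b} {a′} {b′} eq with sorted a b | sorted-cases a b | sorted a′ b′ | sorted-cases a′ b′
  sorted-injective refl | _ | inj₁ refl | _ | inj₁ refl = inj₁ (refl , refl)
  sorted-injective refl | _ | inj₁ refl | _ | inj₂ refl = inj₂ (refl , refl)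
  sorted-injective refl | _ | inj₂ refl | _ | inj₁ refl = inj₂ (refl , refl)
  sorted-injective refl | _ | inj₂ refl | _ | inj₂ refl = inj₁ (refl , refl)

  sorted-comm : ∀ a b → sorted a b ≡ sorted b a
  sorted-comm a b with <-cmp (toℕ a) (toℕ b)
  ... | tri< a<b _ _ = trans (proj₁ (sorted-of-sorted a<b)) (sym (proj₂ (sorted-of-sorted a<b)))
  ... | tri≈ _ a≡b _ rewrite toℕ-injective a≡b = refl
  ... | tri> _ _ b<a = trans (proj₂ (sorted-of-sorted b<a)) (sym (proj₁ (sorted-of-sorted b<a)))

  sorted-ends : ∀ a b → let e = sorted a b in (a ≡ proj₁ e ⊎ a ≡ proj₂ e) × (b ≡ proj₁ e ⊎ b ≡ proj₂ e)
  sorted-ends a b = sorted-both (λ x y → (a ≡ x ⊎ a ≡ y) × (b ≡ x ⊎ b ≡ y)) (inj₁ refl , inj₂ refl) (inj₂ refl , inj₁ refl)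

  endpoints : List (Fin n × Fin n) → VSet n
  endpoints L = tabulate (λ i → any (λ e → i =ᵇ proj₁ e ∨ i =ᵇ proj₂ e) L)

  endpoints⁺ : ∀ {L i e} → e ∈ L → i ≡ proj₁ e ⊎ i ≡ proj₂ e → T (i ∈ᵇ endpoints L)
  endpoints⁺ {L} {i} {e} e∈L i∈e = subst T (sym (lookup∘tabulate _ i)) (any⁺ _ (lose e∈L (incident i∈e)))
    where
    incident : i ≡ proj₁ e ⊎ i ≡ proj₂ e → T (i =ᵇ proj₁ e ∨ i =ᵇ proj₂ e)
    incident (inj₁ i≡) = from T-∨ (inj₁ (=ᵇ-complete i≡))
    incident (inj₂ i≡) = from T-∨ (inj₂ (=ᵇ-complete i≡))

  endpoints⁻ : ∀ {L i} → T (i ∈ᵇ endpoints L) → ∃ λ e → e ∈ L × (i ≡ proj₁ e ⊎ i ≡ proj₂ e)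
  endpoints⁻ {L} {i} i∈ with find (any⁻ _ L (subst T (lookup∘tabulate _ i) i∈))
  ... | e , e∈L , inc = e , e∈L , ⊎-map =ᵇ-sound =ᵇ-sound (to T-∨ inc)

open Pairs

module _ {n : ℕ} (G : Graph n) {K : VSet n} (cl : IsClique G K) where

  clique-adj-sorted : ∀ {x y} → T (x ∈ᵇ K) → T (y ∈ᵇ K) → (x , y) ∈ pairs n → T (adj G x y)
  clique-adj-sorted x∈K y∈K xy∈ with to T-∨ (All.lookup (all⁺ _ (pairs n) cl) xy∈)
  ... | inj₁ not-both = ⊥-elim (subst T (to T-not-≡ not-both) (from T-∧ (x∈K , y∈K)))
  ... | inj₂ xy = xy

  clique-adj : ∀ {i j} → T (i ∈ᵇ K) → T (j ∈ᵇ K) → i ≢ j → T (adj G i j)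
  clique-adj {i} {j} i∈K j∈K i≢j with <-cmp (toℕ i) (toℕ j)
  ... | tri< i<j _ _ = clique-adj-sorted i∈K j∈K (pairs⁺ i<j)
  ... | tri≈ _ i≡j _ = ⊥-elim (i≢j (toℕ-injective i≡j))
  ... | tri> _ _ j<i = subst T (Graph.sym G j i) (clique-adj-sorted j∈K i∈K (pairs⁺ j<i))

module Cluster {n : ℕ} (G : Graph n) (Tc : VSet n) where

  S : VSet n
  S = commonNbhd G Tc

  outside : Fin n → Bool
  outside x = not (x ∈ᵇ Tc ∨ x ∈ᵇ S)

  outside-T : ∀ {x} → T (outside x) → ¬ T (x ∈ᵇ Tc)
  outside-T o x∈T = subst T (to T-not-≡ o) (from T-∨ (inj₁ x∈T))

  outside-S : ∀ {x} → T (outside x) → ¬ T (x ∈ᵇ S)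
  outside-S o x∈S = subst T (to T-not-≡ o) (from T-∨ (inj₂ x∈S))

  S-adj : ∀ {v d} → T (v ∈ᵇ S) → T (d ∈ᵇ Tc) → T (adj G d v)
  S-adj {v} {d} v∈S d∈T with to T-∨ (All.lookup (all⁺ _ (allFin n) (subst T (lookup∘tabulate _ v) v∈S)) (∈-allFin d))
  ... | inj₁ d∉T = ⊥-elim (subst T (to T-not-≡ d∉T) d∈T)
  ... | inj₂ dv = dv

  T∩S-empty : ∀ {x} → T (x ∈ᵇ Tc) → ¬ T (x ∈ᵇ S)
  T∩S-empty {x} x∈T x∈S = subst T (irrefl G x) (S-adj x∈S x∈T)

  -- A vertex d of a tight clique is adjacent to the |Tc| - 1 other vertices
  -- of Tc and to all of S, i.e. to r vertices; with maximum degree r it has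
  -- no further neighbour, in particular none outside.
  tight-closed : ∀ {r} → MaxDegreeAtMost G r → Tight G r Tc →
    ∀ {d v} → T (d ∈ᵇ Tc) → T (adj G d v) → ¬ T (outside v)
  tight-closed {r} maxdeg (_ , clT , size) {d} {v} d∈T dv v-out = <-irrefl refl (≤-trans r<deg (maxdeg d))
    where
    inT inS isV : Fin n → Bool
    inT x = x ∈ᵇ Tc ∧ x ≠ᵇ d
    inS x = x ∈ᵇ S
    isV x = x =ᵇ v

    card-T : card Tc ≡ suc (count inT (allFin n))
    card-T = count-remove _≟_ (_∈ᵇ Tc) (allFin⁺ n) (∈-allFin d) d∈T

    inT#inS : ∀ x → T (inT x) → ¬ T (inS x)
    inT#inS x x∈ = T∩S-empty (proj₁ (to T-∧ x∈))

    inTS#isV : ∀ x → T (inT x ∨ inS x) → ¬ T (isV x)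
    inTS#isV x x∈ x=v with =ᵇ-sound {x = x} {v} x=v | to (T-∨ {inT x}) x∈
    ... | refl | inj₁ x∈T = outside-T v-out (proj₁ (to T-∧ x∈T))
    ... | refl | inj₂ x∈S = outside-S v-out x∈S

    neighbour : ∀ x → T ((inT x ∨ inS x) ∨ isV x) → T (adj G d x)
    neighbour x x∈ with to (T-∨ {inT x ∨ inS x}) x∈
    ... | inj₂ x=v = subst (T ∘ adj G d) (sym (=ᵇ-sound {x = x} x=v)) dv
    ... | inj₁ x∈TS with to (T-∨ {inT x}) x∈TS
    ...   | inj₂ x∈S = S-adj x∈S d∈T
    ...   | inj₁ x∈T′ = let x∈T , x≠d = to T-∧ x∈T′ in
                        clique-adj G {Tc} clT d∈T x∈T (λ d≡x → ≠ᵇ-sound x≠d (sym d≡x))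

    neighbourhood-size : count (λ x → (inT x ∨ inS x) ∨ isV x) (allFin n) ≡ suc r
    neighbourhood-size = begin
      count (λ x → (inT x ∨ inS x) ∨ isV x) (allFin n)
        ≡⟨ count-disjoint (λ x → inT x ∨ inS x) isV (allFin n) inTS#isV ⟩
      count (λ x → inT x ∨ inS x) (allFin n) + count isV (allFin n)
        ≡⟨ cong₂ _+_ (count-disjoint inT inS (allFin n) inT#inS) (count-≟ _≟_ (allFin⁺ n) (∈-allFin v)) ⟩
      (cT + cS) + 1            ≡⟨ +-comm (cT + cS) 1 ⟩
      suc (cT + cS)            ≡⟨ cong suc (+-comm cT cS) ⟩
      suc (cS + cT)            ≡⟨ +-suc cS cT ⟨
      cS + suc cT              ≡⟨ cong (cS +_) card-T ⟨
      cS + card Tc             ≡⟨ size ⟩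
      suc r ∎
      where
      open ≡-Reasoning
      cT = count inT (allFin n)
      cS = count inS (allFin n)

    r<deg : suc r ≤ degree G d
    r<deg = subst (_≤ degree G d) neighbourhood-size (count-mono _ (adj G d) (allFin n) neighbour)

  Arc : Fin n → Fin n → Set
  Arc s o = T (adj G s o) × T (s ∈ᵇ S) × T (outside o)

  Arc-irrefl : ∀ {s o} → Arc s o → s ≢ o
  Arc-irrefl {s} (so , _) refl = subst T (irrefl G s) so

  isBlue⇒Arc : ∀ {u v} → T (isBlueᵇ G Tc u v) → Arc u v ⊎ Arc v u
  isBlue⇒Arc {u} {v} blue with to (T-∧ {adj G u v}) blue
  ... | uv , ends with to (T-∨ {u ∈ᵇ S ∧ outside v}) ends
  ...   | inj₁ so = inj₁ (uv , to T-∧ so)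
  ...   | inj₂ so = inj₂ (subst T (Graph.sym G u v) uv , to T-∧ so)

  Arc⇒isBlue : ∀ {u v} → Arc u v ⊎ Arc v u → T (isBlueᵇ G Tc u v)
  Arc⇒isBlue (inj₁ (uv , s , o)) = from T-∧ (uv , from T-∨ (inj₁ (from T-∧ (s , o))))
  Arc⇒isBlue {u} {v} (inj₂ (vu , s , o)) =
    from T-∧ (subst T (Graph.sym G v u) vu , from T-∨ (inj₂ (from T-∧ (s , o))))

  isBlue : Fin n × Fin n → Bool
  isBlue e = isBlueᵇ G Tc (proj₁ e) (proj₂ e)

  blueEdges : List (Fin n × Fin n)
  blueEdges = filterᵇ isBlue (pairs n)

  -- A clique containing an outside vertex c₀ avoids Tc, since its other
  -- vertices are neighbours of c₀ (tight-closed); so it lies in S ∪ outside.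
  clique-avoids-T : ∀ {r} → MaxDegreeAtMost G r → Tight G r Tc →
    ∀ {K} → IsClique G K → ∀ {c₀} → T (c₀ ∈ᵇ K) → T (outside c₀) →
    ∀ {w} → T (w ∈ᵇ K) → T (w ∈ᵇ S) ⊎ T (outside w)
  clique-avoids-T maxdeg tight {K} cl {c₀} c₀∈K c₀-out {w} w∈K with w ∈ᵇ Tc in w∈T? | w ∈ᵇ S
  ... | true | _ = ⊥-elim (tight-closed maxdeg tight w∈T (clique-adj G {K} cl w∈K c₀∈K w≢c₀) c₀-out)
    where
    w∈T : T (w ∈ᵇ Tc)
    w∈T = from T-≡ w∈T?
    w≢c₀ : w ≢ c₀
    w≢c₀ refl = outside-T c₀-out w∈T
  ... | false | true  = inj₁ tt
  ... | false | false = inj₂ tt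

  module DoubleStar {r : ℕ} (maxdeg : MaxDegreeAtMost G r) (tight : Tight G r Tc)
    {K : VSet n} (cl : IsClique G K) {a₀ c₀ : Fin n}
    (a₀∈K : T (a₀ ∈ᵇ K)) (a₀∈S : T (a₀ ∈ᵇ S)) (c₀∈K : T (c₀ ∈ᵇ K)) (c₀-out : T (outside c₀)) where

    adjacent : ∀ {i j} → T (i ∈ᵇ K) → T (j ∈ᵇ K) → i ≢ j → T (adj G i j)
    adjacent = clique-adj G {K} cl

    in-S-or-outside : ∀ {w} → T (w ∈ᵇ K) → T (w ∈ᵇ S) ⊎ T (outside w)
    in-S-or-outside = clique-avoids-T maxdeg tight {K} cl c₀∈K c₀-out

    hub : Fin n → Bool
    hub z = z =ᵇ a₀ ∨ z =ᵇ c₀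

    inStar : Fin n × Fin n → Bool
    inStar e = (proj₁ e ∈ᵇ K ∧ proj₂ e ∈ᵇ K) ∧ (hub (proj₁ e) ∨ hub (proj₂ e))

    star : List (Fin n × Fin n)
    star = filterᵇ inStar blueEdges

    rest : List (Fin n)
    rest = filterᵇ (λ x → x ∈ᵇ K ∧ x ≠ᵇ a₀) (allFin n)

    card-K : card K ≡ suc (length rest)
    card-K = count-remove _≟_ (_∈ᵇ K) (allFin⁺ n) (∈-allFin a₀) a₀∈K

    rest⁺ : ∀ {w} → T (w ∈ᵇ K) → w ≢ a₀ → w ∈ rest
    rest⁺ {w} w∈K w≢a₀ = ∈-filter⁺ (T? ∘ λ x → x ∈ᵇ K ∧ x ≠ᵇ a₀) (∈-allFin w) (from T-∧ (w∈K , ≠ᵇ-complete w≢a₀))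

    rest⁻ : ∀ {w} → w ∈ rest → T (w ∈ᵇ K) × w ≢ a₀
    rest⁻ w∈ with to T-∧ (proj₂ (∈-filter⁻ (T? ∘ λ x → x ∈ᵇ K ∧ x ≠ᵇ a₀) {xs = allFin n} w∈))
    ... | w∈K , w≠a₀ = w∈K , ≠ᵇ-sound w≠a₀

    hub-end : ∀ {s o} → Arc s o → T (hub s) ⊎ T (hub o) → s ≡ a₀ ⊎ o ≡ c₀
    hub-end {s} {o} (_ , s∈S , o-out) at-hub with at-hub
    ... | inj₁ s-hub with to (T-∨ {s =ᵇ a₀}) s-hub
    ...   | inj₁ s=a₀ = inj₁ (=ᵇ-sound s=a₀)
    ...   | inj₂ s=c₀ = ⊥-elim (outside-S c₀-out (subst (λ z → T (z ∈ᵇ S)) (=ᵇ-sound s=c₀) s∈S))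
    hub-end {s} {o} (_ , s∈S , o-out) _ | inj₂ o-hub with to (T-∨ {o =ᵇ a₀}) o-hub
    ...   | inj₁ o=a₀ = ⊥-elim (outside-S o-out (subst (λ z → T (z ∈ᵇ S)) (sym (=ᵇ-sound o=a₀)) a₀∈S))
    ...   | inj₂ o=c₀ = inj₂ (=ᵇ-sound o=c₀)

    star⁺ : ∀ {s o} → Arc s o → T (s ∈ᵇ K) → T (o ∈ᵇ K) → s ≡ a₀ ⊎ o ≡ c₀ → sorted s o ∈ star
    star⁺ {s} {o} arc s∈K o∈K at-hub =
      ∈-filter⁺ (T? ∘ inStar) (∈-filter⁺ (T? ∘ isBlue) (sorted∈pairs (Arc-irrefl arc)) (proj₁ in-both)) (proj₂ in-both)
      where
      hubs : T (hub s) ⊎ T (hub o)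
      hubs = ⊎-map (λ s≡a₀ → from T-∨ (inj₁ (=ᵇ-complete s≡a₀))) (λ o≡c₀ → from T-∨ (inj₂ (=ᵇ-complete o≡c₀))) at-hub
      InStar : Fin n → Fin n → Set
      InStar x y = T (isBlueᵇ G Tc x y) × T (inStar (x , y))
      in-both : InStar (proj₁ (sorted s o)) (proj₂ (sorted s o))
      in-both = sorted-both InStar
        (Arc⇒isBlue (inj₁ arc) , from T-∧ (from T-∧ (s∈K , o∈K) , from T-∨ hubs))
        (Arc⇒isBlue (inj₂ arc) , from T-∧ (from T-∧ (o∈K , s∈K) , from T-∨ (swap hubs)))

    in-star : ∀ {e} → e ∈ star → T (inStar e)
    in-star e∈ = proj₂ (∈-filter⁻ (T? ∘ inStar) {xs = blueEdges} e∈)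

    star-in-K : ∀ {e} → e ∈ star → T (proj₁ e ∈ᵇ K) × T (proj₂ e ∈ᵇ K)
    star-in-K {e} e∈ = to T-∧ (proj₁ (to (T-∧ {proj₁ e ∈ᵇ K ∧ proj₂ e ∈ᵇ K}) (in-star e∈)))

    star⁻ : ∀ {e} → e ∈ star → ∃ λ s → ∃ λ o →
      e ≡ sorted s o × Arc s o × T (s ∈ᵇ K) × T (o ∈ᵇ K) × (s ≡ a₀ ⊎ o ≡ c₀)
    star⁻ {x , y} e∈ with ∈-filter⁻ (T? ∘ isBlue) {xs = pairs n} (proj₁ (∈-filter⁻ (T? ∘ inStar) {xs = blueEdges} e∈))
    ... | e∈pairs , blue with sorted-of-sorted (pairs⁻ e∈pairs) | to T-∧ (in-star e∈)
    ... | xy , yx | _ , hubs with star-in-K e∈ | isBlue⇒Arc blue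
    ... | x∈K , y∈K | inj₁ arc = x , y , sym xy , arc , x∈K , y∈K , hub-end arc (to T-∨ hubs)
    ... | x∈K , y∈K | inj₂ arc = y , x , sym yx , arc , y∈K , x∈K , hub-end arc (swap (to T-∨ hubs))

    partner : Fin n → Fin n
    partner w = if w ∈ᵇ S then c₀ else a₀

    partner-S : ∀ {w} → T (w ∈ᵇ S) → partner w ≡ c₀
    partner-S {w} w∈S with w ∈ᵇ S
    ... | true = refl

    partner-out : ∀ {w} → T (outside w) → partner w ≡ a₀
    partner-out {w} w-out with w ∈ᵇ S | outside-S w-out
    ... | true  | w∉S = ⊥-elim (w∉S tt)
    ... | false | _   = refl

    spoke : Fin n → Fin n × Fin n
    spoke w = sorted w (partner w)

    spoke∈star : ∀ {w} → w ∈ rest → spoke w ∈ star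
    spoke∈star {w} w∈ with rest⁻ w∈
    ... | w∈K , w≢a₀ with in-S-or-outside w∈K
    ... | inj₁ w∈S = subst (_∈ star) (cong (sorted w) (sym (partner-S w∈S)))
          (star⁺ (adjacent w∈K c₀∈K w≢c₀ , w∈S , c₀-out) w∈K c₀∈K (inj₂ refl))
      where
      w≢c₀ : w ≢ c₀
      w≢c₀ refl = outside-S c₀-out w∈S
    ... | inj₂ w-out = subst (_∈ star) (trans (sorted-comm a₀ w) (cong (sorted w) (sym (partner-out w-out))))
          (star⁺ (adjacent a₀∈K w∈K (w≢a₀ ∘ sym) , a₀∈S , w-out) a₀∈K w∈K (inj₁ refl))

    spoke-injective : ∀ {w w′} → w ∈ rest → w′ ∈ rest → spoke w ≡ spoke w′ → w ≡ w′
    spoke-injective {w} {w′} w∈ w′∈ eq with sorted-injective eq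
    ... | inj₁ (w≡w′ , _) = w≡w′
    ... | inj₂ (w≡p′ , p≡w′) with rest⁻ w∈ | rest⁻ w′∈
    ... | w∈K , w≢a₀ | w′∈K , w′≢a₀
        with in-S-or-outside w∈K | in-S-or-outside w′∈K
    ... | _ | inj₂ w′-out = ⊥-elim (w≢a₀ (trans w≡p′ (partner-out w′-out)))
    ... | inj₂ w-out | _ = ⊥-elim (w′≢a₀ (trans (sym p≡w′) (partner-out w-out)))
    ... | inj₁ w∈S | inj₁ w′∈S =
          ⊥-elim (outside-S c₀-out (subst (λ z → T (z ∈ᵇ S)) (trans w≡p′ (partner-S w′∈S)) w∈S))

    star-covered : ∀ {e} → e ∈ star → ∃ λ w → w ∈ rest × spoke w ≡ e
    star-covered e∈ with star⁻ e∈
    ... | s , o , e≡ , (_ , s∈S , o-out) , s∈K , o∈K , at-hub with s ≟ a₀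
    ... | yes refl = o , rest⁺ o∈K o≢a₀ ,
                     trans (cong (sorted o) (partner-out o-out)) (trans (sorted-comm o s) (sym e≡))
      where
      o≢a₀ : o ≢ s
      o≢a₀ refl = outside-S o-out s∈S
    ... | no s≢a₀ with at-hub
    ...   | inj₁ s≡a₀ = ⊥-elim (s≢a₀ s≡a₀)
    ...   | inj₂ refl = s , rest⁺ s∈K s≢a₀ , trans (cong (sorted s) (partner-S s∈S)) (sym e≡)

    star-unique : Unique star
    star-unique = filter⁺ (T? ∘ inStar) (filter⁺ (T? ∘ isBlue) pairs-unique)

    length-star : length star ≡ length rest
    length-star = ≤-antisym (cover-length spoke star-unique star-covered) (begin
      length rest              ≡⟨ length-map spoke rest ⟨
      length (map spoke rest)  ≤⟨ ⊆-length spokes-unique spokes⊆star ⟩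
      length star              ∎)
      where
      open ≤-Reasoning
      spokes-unique : Unique (map spoke rest)
      spokes-unique = map-unique-on spoke spoke-injective (filter⁺ _ (allFin⁺ n))
      spokes⊆star : map spoke rest ⊆ star
      spokes⊆star e∈ with ∈-map⁻ spoke e∈
      ... | w , w∈ , refl = spoke∈star w∈

    endpoints-star : endpoints star ≡ K
    endpoints-star = vset-ext ends⊆K K⊆ends
      where
      ends⊆K : ∀ i → T (i ∈ᵇ endpoints star) → T (i ∈ᵇ K)
      ends⊆K i i∈ with endpoints⁻ {L = star} i∈
      ... | e , e∈ , inj₁ refl = proj₁ (star-in-K e∈)
      ... | e , e∈ , inj₂ refl = proj₂ (star-in-K e∈)
      K⊆ends : ∀ i → T (i ∈ᵇ K) → T (i ∈ᵇ endpoints star)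
      K⊆ends i i∈K with i ≟ a₀
      ... | no i≢a₀ = endpoints⁺ (spoke∈star (rest⁺ i∈K i≢a₀)) (proj₁ (sorted-ends i (partner i)))
      ... | yes refl = endpoints⁺ (spoke∈star (rest⁺ c₀∈K c₀≢a₀))
            (subst (λ p → a₀ ≡ proj₁ (sorted c₀ p) ⊎ a₀ ≡ proj₂ (sorted c₀ p))
                   (sym (partner-out c₀-out)) (proj₂ (sorted-ends c₀ a₀)))
        where
        c₀≢a₀ : c₀ ≢ a₀
        c₀≢a₀ refl = outside-S c₀-out a₀∈S

  blueEdgeSets : ℕ → List (List (Fin n × Fin n))
  blueEdgeSets k = filterᵇ (HasLength k) (sublists blueEdges)

  module _ {r : ℕ} (maxdeg : MaxDegreeAtMost G r) (tight : Tight G r Tc) (t : ℕ) where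

    double-star-encoding : ∀ {K} → IsClique G K → card K ≡ t →
      ∀ {a₀ c₀} → T (a₀ ∈ᵇ K) → T (a₀ ∈ᵇ S) → T (c₀ ∈ᵇ K) → T (outside c₀) →
      ∃ λ F → F ∈ blueEdgeSets (t ∸ 1) × endpoints F ≡ K
    double-star-encoding {K} cl |K|≡t a₀∈K a₀∈S c₀∈K c₀-out =
      star , ∈-filter⁺ (T? ∘ HasLength (t ∸ 1)) (filter∈sublists inStar blueEdges) (≡⇒≡ᵇ _ _ star-size) ,
      endpoints-star
      where
      open DoubleStar maxdeg tight {K} cl a₀∈K a₀∈S c₀∈K c₀-out
      star-size : length star ≡ t ∸ 1
      star-size = trans length-star (cong (_∸ 1) (trans (sym card-K) |K|≡t))

    isBlueClique : VSet n → Bool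
    isBlueClique K = (card K ≡ᵇ t) ∧ isCliqueᵇ G K ∧ containsBlueᵇ G Tc K

    blue-clique-encoding : ∀ {K} → T (isBlueClique K) → ∃ λ F → F ∈ blueEdgeSets (t ∸ 1) × endpoints F ≡ K
    blue-clique-encoding {K} K-blue with to (T-∧ {card K ≡ᵇ t}) K-blue
    ... | size , clique-with-blue with to (T-∧ {isCliqueᵇ G K}) clique-with-blue
    ... | cl , has-blue with find (any⁻ _ (pairs n) has-blue)
    ... | (u , v) , _ , uv-blue-in-K with to (T-∧ {u ∈ᵇ K}) uv-blue-in-K
    ... | u∈K , v-blue with to (T-∧ {v ∈ᵇ K}) v-blue
    ... | v∈K , blue with isBlue⇒Arc blue
    ...   | inj₁ (_ , u∈S , v-out) = double-star-encoding cl (≡ᵇ⇒≡ (card K) t size) u∈K u∈S v∈K v-out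
    ...   | inj₂ (_ , v∈S , u-out) = double-star-encoding cl (≡ᵇ⇒≡ (card K) t size) v∈K v∈S u∈K u-out

    -- Blue t-cliques are determined by distinct (t-1)-sets of blue edges.
    blue-clique-bound : numBlueCliques G Tc t ≤ numBlueEdges G Tc C (t ∸ 1)
    blue-clique-bound = begin
      numBlueCliques G Tc t            ≤⟨ cover-length endpoints cliques-unique encoding ⟩
      length (blueEdgeSets (t ∸ 1))    ≡⟨ count-sublists (t ∸ 1) blueEdges ⟩
      numBlueEdges G Tc C (t ∸ 1)      ∎
      where
      open ≤-Reasoning
      cliques-unique : Unique (filterᵇ isBlueClique (allSubsets n))
      cliques-unique = filter⁺ (T? ∘ isBlueClique) (allSubsets-unique n)
      encoding : ∀ {K} → K ∈ filterᵇ isBlueClique (allSubsets n) →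
        ∃ λ F → F ∈ blueEdgeSets (t ∸ 1) × endpoints F ≡ K
      encoding K∈ = blue-clique-encoding (proj₂ (∈-filter⁻ (T? ∘ isBlueClique) {xs = allSubsets n} K∈))

proposition3p3 : (m r : ℕ) → 1 ≤ r → (n : ℕ) → (G : Graph n) →
    Connected G → numEdges G ≡ m → MaxDegreeAtMost G r →
    (Tc : VSet n) → IsCluster G r Tc →
    (t : ℕ) → t ≥ 2 →
    numBlueCliques G Tc t ≤ (numBlueEdges G Tc) C (t ∸ 1)
proposition3p3 m r _ n G _ _ maxdeg Tc (tight , _) t _ = Cluster.blue-clique-bound G Tc maxdeg tight t
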